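{- In $\mathcal{R}$-Wythoff, a position $(a,b)$ with $a \leq b$ has Sprague-Grundy value $1$ if and only if $(a,b)$ belongs to the set \[\{(2,2), (4,6)\} \cup \{(\lfloor \phi n \rfloor - 1, \lfloor \phi n \rfloor +n-1) : n \geq 1, n \neq 2\},\] where $\phi=(1+\sqrt5)/2$.
   Context: A position is an unordered pair $(a,b)$ of nonnegative integers (pile sizes). $\mathcal{R}$-Wythoff: a move either removes a positive number of tokens from the larger pile (or from either pile if both piles have equal size), or removes the same positive number of tokens from both piles. The Sprague-Grundy function is defined by $\mathcal{G}(p)=\mathrm{mex}\{\mathcal{G}(q): q \text{ reachable from } p \text{ in one move}\}$, where $\mathrm{mex}(S)$ is the smallest nonnegative integer not in $S$ and $\mathrm{mex}\{\}=0$. -}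

module Defs where

open import Data.Nat using (ℕ; zero; suc; _+_; _*_; _∸_; _≤_; _<_; _≡ᵇ_; _⊔_; _⊓_)
open import Data.Bool using (if_then_else_)
open import Data.List using (List; []; _∷_; map; _++_; length; upTo)
open import Data.Bool.ListAction using (any)
open import Data.Product using (_×_; _,_; proj₁; proj₂)
open import Data.Sum using (_⊎_)

-- mex of a finite list of naturals: the least n not occurring in the list.
-- Scans candidates 0,1,...,length xs (one of these is always missing).
mexGo : ℕ → ℕ → List ℕ → ℕ
mexGo zero n xs = n
mexGo (suc k) n xs = if any (n ≡ᵇ_) xs then mexGo k (suc n) xs else n

mex : List ℕ → ℕ
mex xs = mexGo (length xs) 0 xs

-- Positions are unordered pairs; we work with the normalised pair (x , y), x ≤ y.
-- R-Wythoff options of (x , y) with x ≤ y: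
--   remove k ∈ {1..y} from the larger pile y  (if x = y this covers either pile),
--   remove k ∈ {1..x} from both piles.
options : ℕ → ℕ → List (ℕ × ℕ)
options a b =
  let x = a ⊓ b ; y = a ⊔ b in
  map (λ i → (x , y ∸ suc i)) (upTo y) ++ map (λ i → (x ∸ suc i , y ∸ suc i)) (upTo x)

-- Sprague–Grundy value computed with fuel; every move strictly lowers a + b,
-- so fuel a + b + 1 is enough to reach terminal positions.
grundyF : ℕ → ℕ → ℕ → ℕ
grundyF zero a b = 0
grundyF (suc f) a b = mex (map (λ p → grundyF f (proj₁ p) (proj₂ p)) (options a b))

𝒢 : ℕ → ℕ → ℕ
𝒢 a b = grundyF (suc (a + b)) a b

-- φ = (1+√5)/2.  For naturals m, n:
--   m ≤ φ n  ⇔  2m − n ≤ √5 n  ⇔  2m ≤ n  or  (2m − n)² ≤ 5 n²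
LeqPhi : ℕ → ℕ → Set
LeqPhi m n = (2 * m ≤ n) ⊎ ((2 * m ∸ n) * (2 * m ∸ n) ≤ 5 * (n * n))

--   φ n < k  ⇔  √5 n < 2k − n  ⇔  n < 2k  and  5 n² < (2k − n)²
PhiLt : ℕ → ℕ → Set
PhiLt n k = (n < 2 * k) × (5 * (n * n) < (2 * k ∸ n) * (2 * k ∸ n))

-- m = ⌊φ n⌋  ⇔  m ≤ φ n < m + 1
IsFloorPhi : ℕ → ℕ → Set
IsFloorPhi n m = LeqPhi m n × PhiLt n (suc m)

module Submission where

-- Positions are normalised as (a , a + d).  The proof characterises the positions of
-- value 0 and of value 1 simultaneously, by induction on the number of tokens:
--   P = { (⌊φ d⌋ , ⌊φ d⌋ + d) }                       (the Wythoff P-positions),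
--   Q = { (2,2), (4,6) } ∪ { (⌊φ d⌋ − 1 , ⌊φ d⌋ − 1 + d) : d ≥ 1, d ≠ 2 }.

open import Defs
open import Data.Bool using (true; false; T)
open import Data.Bool.ListAction using (any)
open import Data.Empty using (⊥-elim)
open import Data.List using (List; []; _∷_; map; _++_; length; upTo)
open import Data.List.Properties using (map-cong-local)
open import Data.List.Relation.Unary.All as All using (All)
open import Data.List.Relation.Unary.Any as Any using (Any)
import Data.List.Relation.Unary.All.Properties as Allₚ
import Data.List.Relation.Unary.Any.Properties as Anyₚ
open import Data.Nat
open import Data.Nat.Induction using (<-wellFounded)
open import Data.Nat.Properties
open import Data.Nat.Tactic.RingSolver using (solve-∀)
open import Data.Product using (_×_; _,_; proj₁; proj₂; ∃-syntax)
open import Data.Sum using (_⊎_; inj₁; inj₂)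
open import Function using (id)
open import Function.Bundles using (_⇔_; mk⇔; Equivalence)
import Function.Properties.Equivalence as ⇔
open import Induction.WellFounded using (Acc; acc)
open import Relation.Binary.Definitions using (tri<; tri≈; tri>)
open import Relation.Binary.PropositionalEquality
open import Relation.Nullary using (¬_; Dec; yes; no)
open import Relation.Nullary.Decidable using (map′; T?; _×-dec_; _⊎-dec_; ¬?)

-- Comparisons of a natural m with φ·n, expressed without φ: since φ² = φ + 1,
-- m ≤ φ n  ⇔  m² ≤ m n + n².  Records keep the two arguments inferable.
record _≤φ_ (m n : ℕ) : Set where
  constructor ≤φ-intro
  field ≤φ-sq : m * m ≤ m * n + n * n

record _<φ_ (m n : ℕ) : Set where
  constructor <φ-intro
  field <φ-sq : m * m < m * n + n * n

record _>φ_ (m n : ℕ) : Set where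
  constructor >φ-intro
  field >φ-sq : m * n + n * n < m * m

open _≤φ_
open _<φ_
open _>φ_

<φ⇒≤φ : ∀ {m n} → m <φ n → m ≤φ n
<φ⇒≤φ (<φ-intro h) = ≤φ-intro (<⇒≤ h)

>φ⇒≰φ : ∀ {m n} → m >φ n → ¬ m ≤φ n
>φ⇒≰φ (>φ-intro h) (≤φ-intro l) = <⇒≱ h l

≰φ⇒>φ : ∀ {m n} → ¬ m ≤φ n → m >φ n
≰φ⇒>φ m≰φn = >φ-intro (≰⇒> (λ l → m≰φn (≤φ-intro l)))

≯φ⇒≤φ : ∀ {m n} → ¬ m >φ n → m ≤φ n
≯φ⇒≤φ m≯φn = ≤φ-intro (≮⇒≥ (λ h → m≯φn (>φ-intro h)))

_≤φ?_ : ∀ m n → Dec (m ≤φ n)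
m ≤φ? n = map′ ≤φ-intro ≤φ-sq (m * m ≤? m * n + n * n)

_>φ?_ : ∀ m n → Dec (m >φ n)
m >φ? n = map′ >φ-intro >φ-sq (m * n + n * n <? m * m)

cancel-≤ : ∀ {P Q R S} → P + Q ≡ R + S → P ≤ R → S ≤ Q
cancel-≤ {P} {Q} {R} {S} eq P≤R =
  +-cancelˡ-≤ R S Q (subst (_≤ R + Q) eq (+-monoˡ-≤ Q P≤R))

cancel-< : ∀ {P Q R S} → P + Q ≡ R + S → P < R → S < Q
cancel-< {P} {Q} {R} {S} eq P<R =
  +-cancelˡ-< R S Q (subst (_< R + Q) eq (+-monoˡ-< Q P<R))

cancel-≤ʳ : ∀ {P Q R S} → P + Q ≡ R + S → S ≤ Q → P ≤ R
cancel-≤ʳ {P} {Q} {R} {S} eq = cancel-≤ (trans (+-comm S R) (trans (sym eq) (+-comm P Q)))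

cancel-<ʳ : ∀ {P Q R S} → P + Q ≡ R + S → Q < S → R < P
cancel-<ʳ {P} {Q} {R} {S} eq = cancel-< (trans (+-comm Q P) (trans eq (+-comm R S)))

-- Reciprocity, from 1/φ = φ − 1:  x < φ y  ⇔  x + y > φ x,  and  x > φ y  ⇔  x + y < φ x.
golden-swap : ∀ x y → x * x + (x + y) * (x + y) ≡ (x * y + y * y) + ((x + y) * x + x * x)
golden-swap = solve-∀

<φ⇒+>φ : ∀ {x y} → x <φ y → (x + y) >φ x
<φ⇒+>φ {x} {y} (<φ-intro h) = >φ-intro (cancel-< (golden-swap x y) h)

+>φ⇒<φ : ∀ {x y} → (x + y) >φ x → x <φ y
+>φ⇒<φ {x} {y} (>φ-intro h) = <φ-intro (cancel-<ʳ (sym (golden-swap x y)) h)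

>φ⇒+<φ : ∀ {x y} → x >φ y → (x + y) <φ x
>φ⇒+<φ {x} {y} (>φ-intro h) = <φ-intro (cancel-< (sym (golden-swap x y)) h)

+<φ⇒>φ : ∀ {x y} → (x + y) <φ x → x >φ y
+<φ⇒>φ {x} {y} (<φ-intro h) = >φ-intro (cancel-<ʳ (golden-swap x y) h)

≤⇒<φ : ∀ {a k} → 1 ≤ k → a ≤ k → a <φ k
≤⇒<φ {a} {k} k≥1 a≤k =
  <φ-intro (≤-<-trans (*-monoʳ-≤ a a≤k) (m<m+n (a * k) (*-mono-≤ k≥1 k≥1)))

>φ⇒> : ∀ {b k} → b >φ k → k < b
>φ⇒> {b} {k} b>φk with k <? b
... | yes k<b = k<b
... | no k≮b = ⊥-elim (>φ⇒≰φ b>φk (≤φ-intro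
        (≤-trans (*-monoʳ-≤ b (≮⇒≥ k≮b)) (m≤m+n (b * k) (k * k)))))

-- t ↦ t² − t k is increasing for t ≥ k:  (b+t)k + k² + b² ≤ bk + k² + (b+t)².
square-growth : ∀ b t k → k ≤ b →
  ((b + t) * k + k * k) + b * b ≤ (b * k + k * k) + (b + t) * (b + t)
square-growth b t k k≤b = begin
  ((b + t) * k + k * k) + b * b           ≡⟨ lhs b t k ⟩
  (b * k + k * k + b * b) + t * k         ≤⟨ +-monoʳ-≤ (b * k + k * k + b * b) tk≤ ⟩
  (b * k + k * k + b * b) + (t * b + (b * t + t * t)) ≡⟨ rhs b t k ⟩
  (b * k + k * k) + (b + t) * (b + t)     ∎
  where
  open ≤-Reasoning
  lhs : ∀ b t k → ((b + t) * k + k * k) + b * b ≡ (b * k + k * k + b * b) + t * k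
  lhs = solve-∀
  rhs : ∀ b t k → (b * k + k * k + b * b) + (t * b + (b * t + t * t)) ≡ (b * k + k * k) + (b + t) * (b + t)
  rhs = solve-∀
  tk≤ : t * k ≤ t * b + (b * t + t * t)
  tk≤ = ≤-trans (*-monoʳ-≤ t k≤b) (m≤m+n (t * b) _)

>φ-mono : ∀ {b a k} → b >φ k → b ≤ a → a >φ k
>φ-mono {b} {k = k} b>φk@(>φ-intro h) b≤a with m≤n⇒∃[o]m+o≡n b≤a
... | t , refl = >φ-intro (+-cancelʳ-< (b * b) _ _ (begin-strict
  ((b + t) * k + k * k) + b * b       ≤⟨ square-growth b t k (<⇒≤ (>φ⇒> b>φk)) ⟩
  (b * k + k * k) + (b + t) * (b + t) <⟨ +-monoˡ-< ((b + t) * (b + t)) h ⟩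
  b * b + (b + t) * (b + t)           ≡⟨ +-comm (b * b) _ ⟩
  (b + t) * (b + t) + b * b           ∎))
  where open ≤-Reasoning

≤φ->φ⇒< : ∀ {a b k} → a ≤φ k → b >φ k → a < b
≤φ->φ⇒< {a} {b} a≤φk b>φk with b ≤? a
... | yes b≤a = ⊥-elim (>φ⇒≰φ (>φ-mono b>φk b≤a) a≤φk)
... | no b≰a = ≰⇒> b≰a

-- φ is irrational: a² = a k + k² forces k = 0.  Infinite descent (a , k) ↦ (k , a − k).
golden-descent : ∀ k c → (k + c) * (k + c) ≡ (k + c) * k + k * k → k * k ≡ k * c + c * c
golden-descent k c e = sym (+-cancelʳ-≡ (k * k + k * c) _ _ (begin
  k * c + c * c + (k * k + k * c) ≡⟨ expand-lhs k c ⟩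
  (k + c) * (k + c)               ≡⟨ e ⟩
  (k + c) * k + k * k             ≡⟨ expand-rhs k c ⟩
  k * k + (k * k + k * c)         ∎))
  where
  open ≡-Reasoning
  expand-lhs : ∀ k c → k * c + c * c + (k * k + k * c) ≡ (k + c) * (k + c)
  expand-lhs = solve-∀
  expand-rhs : ∀ k c → (k + c) * k + k * k ≡ k * k + (k * k + k * c)
  expand-rhs = solve-∀

-- If k + 1 ≤ a, write a = (k + 1) + c; then (k + 1 , c) is again a solution, and
-- c < k + 1 since a ≤ k < φ k is impossible for a solution.  So c = 0 by induction,
-- leaving (k + 1)² = 0.
φ-irrational : ∀ a k → a * a ≡ a * k + k * k → k ≡ 0
φ-irrational a k = go a k (<-wellFounded k)
  where
  not-golden : ∀ {a k} → 1 ≤ k → a ≤ k → a * a ≢ a * k + k * k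
  not-golden k≥1 a≤k e = <-irrefl e (<φ-sq (≤⇒<φ k≥1 a≤k))
  go : ∀ a k → Acc _<_ k → a * a ≡ a * k + k * k → k ≡ 0
  go a zero _ _ = refl
  go a (suc k) (acc rec) e with suc k ≤? a
  ... | no k≰a = ⊥-elim (not-golden (s≤s z≤n) (<⇒≤ (≰⇒> k≰a)) e)
  ... | yes k≤a with m≤n⇒∃[o]m+o≡n k≤a
  ... | c , refl with c <? suc k
  ... | no c≮k =
    ⊥-elim (not-golden (≤-trans (s≤s z≤n) (≮⇒≥ c≮k)) (≮⇒≥ c≮k) (golden-descent (suc k) c e))
  ... | yes c<k with go (suc k) c (rec c<k) (golden-descent (suc k) c e)
  ... | refl = ⊥-elim (1+n≢0 (trans (golden-descent (suc k) 0 e) (cong (_+ 0) (*-zeroʳ (suc k)))))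

≤φ⇒<φ : ∀ {a k} → 1 ≤ k → a ≤φ k → a <φ k
≤φ⇒<φ {a} {suc k} _ (≤φ-intro l) =
  <φ-intro (≤∧≢⇒< l (λ e → 1+n≢0 (φ-irrational a (suc k) e)))

-- The constraints LeqPhi / PhiLt of Defs (phrased with √5 n) are the same comparisons:
-- for d = 2m − n one has  d² + 4(m n + n²) = 5 n² + 4 m².
√5-identity : ∀ d n m → d + n ≡ 2 * m → d * d + 4 * (m * n + n * n) ≡ 5 * (n * n) + 4 * (m * m)
√5-identity d n m e = begin
  d * d + 4 * (m * n + n * n)                 ≡⟨ cong (d * d +_) (double m n) ⟩
  d * d + ((2 * m) * n * 2 + 4 * (n * n))     ≡⟨ cong (λ z → d * d + (z * n * 2 + 4 * (n * n))) (sym e) ⟩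
  d * d + ((d + n) * n * 2 + 4 * (n * n))     ≡⟨ complete-square d n ⟩
  5 * (n * n) + (d + n) * (d + n)             ≡⟨ cong (λ z → 5 * (n * n) + z * z) e ⟩
  5 * (n * n) + (2 * m) * (2 * m)             ≡⟨ cong (5 * (n * n) +_) (square-double m) ⟩
  5 * (n * n) + 4 * (m * m)                   ∎
  where
  open ≡-Reasoning
  double : ∀ m n → 4 * (m * n + n * n) ≡ (2 * m) * n * 2 + 4 * (n * n)
  double = solve-∀
  complete-square : ∀ d n → d * d + ((d + n) * n * 2 + 4 * (n * n)) ≡ 5 * (n * n) + (d + n) * (d + n)
  complete-square = solve-∀
  square-double : ∀ m → (2 * m) * (2 * m) ≡ 4 * (m * m)
  square-double = solve-∀

√5-form : ∀ {m n} → n ≤ 2 * m →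
  (2 * m ∸ n) * (2 * m ∸ n) + 4 * (m * n + n * n) ≡ 5 * (n * n) + 4 * (m * m)
√5-form {m} {n} n≤2m = √5-identity (2 * m ∸ n) n m (m∸n+n≡m n≤2m)

half-≤φ : ∀ {m n} → 2 * m ≤ n → m ≤φ n
half-≤φ {m} {n} 2m≤n =
  ≤φ-intro (≤-trans (*-monoʳ-≤ m (≤-trans (m≤m+n m (m + 0)) 2m≤n)) (m≤m+n (m * n) (n * n)))

LeqPhi⇒≤φ : ∀ {m n} → LeqPhi m n → m ≤φ n
LeqPhi⇒≤φ (inj₁ 2m≤n) = half-≤φ 2m≤n
LeqPhi⇒≤φ {m} {n} (inj₂ h) with 2 * m ≤? n
... | yes 2m≤n = half-≤φ 2m≤n
... | no 2m≰n = ≤φ-intro (*-cancelˡ-≤ 4 (cancel-≤ (√5-form {m} (<⇒≤ (≰⇒> 2m≰n))) h))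

≤φ⇒LeqPhi : ∀ {m n} → m ≤φ n → LeqPhi m n
≤φ⇒LeqPhi {m} {n} (≤φ-intro l) with 2 * m ≤? n
... | yes 2m≤n = inj₁ 2m≤n
... | no 2m≰n = inj₂ (cancel-≤ʳ (√5-form {m} (<⇒≤ (≰⇒> 2m≰n))) (*-monoʳ-≤ 4 l))

PhiLt⇒>φ : ∀ {n k} → PhiLt n k → k >φ n
PhiLt⇒>φ {n} {k} (n<2k , h) = >φ-intro (*-cancelˡ-< 4 _ _ (cancel-< (sym (√5-form {k} (<⇒≤ n<2k))) h))

>φ⇒PhiLt : ∀ {n k} → k >φ n → PhiLt n k
>φ⇒PhiLt {n} {k} k>φn@(>φ-intro h) = n<2k , cancel-<ʳ (√5-form {k} (<⇒≤ n<2k)) (*-monoʳ-< 4 h)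
  where
  n<2k : n < 2 * k
  n<2k = <-≤-trans (>φ⇒> k>φn) (m≤m+n k (k + 0))

last-before-failure : (P : ℕ → Set) → (∀ n → Dec (P n)) → ∀ N → P 0 → ¬ P N →
  ∃[ m ] (P m × ¬ P (suc m))
last-before-failure P P? zero P0 ¬PN = ⊥-elim (¬PN P0)
last-before-failure P P? (suc N) P0 ¬PN with P? N
... | yes PN = N , PN , ¬PN
... | no ¬PN′ = last-before-failure P P? N P0 ¬PN′

2n+1>φn : ∀ n → suc (2 * n) >φ n
2n+1>φn n = >φ-intro (subst ((1 + 2 * n) * n + n * n <_) (sym (expand n))
  (s≤s (m≤m+n ((1 + 2 * n) * n + n * n) (n * n + 3 * n))))
  where
  expand : ∀ n → (1 + 2 * n) * (1 + 2 * n) ≡ 1 + (((1 + 2 * n) * n + n * n) + (n * n + 3 * n))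
  expand = solve-∀

floor-exists : ∀ n → ∃[ m ] (m ≤φ n × suc m >φ n)
floor-exists n with last-before-failure (_≤φ n) (_≤φ? n) (suc (2 * n))
                      (≤φ-intro z≤n) (>φ⇒≰φ (2n+1>φn n))
... | m , m≤φn , m+1≰φn = m , m≤φn , ≰φ⇒>φ m+1≰φn

-- The lower Wythoff sequence ⌊φ n⌋.  Only its defining property and its first five
-- values are used; keeping it abstract stops the type checker from unfolding the search.
abstract
  ⌊φ_⌋ : ℕ → ℕ
  ⌊φ n ⌋ = proj₁ (floor-exists n)

  ⌊φ⌋-lower : ∀ n → ⌊φ n ⌋ ≤φ n
  ⌊φ⌋-lower n = proj₁ (proj₂ (floor-exists n))

  ⌊φ⌋-upper : ∀ n → suc ⌊φ n ⌋ >φ n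
  ⌊φ⌋-upper n = proj₂ (proj₂ (floor-exists n))

  ⌊φ0⌋ : ⌊φ 0 ⌋ ≡ 0
  ⌊φ0⌋ = refl
  ⌊φ1⌋ : ⌊φ 1 ⌋ ≡ 1
  ⌊φ1⌋ = refl
  ⌊φ2⌋ : ⌊φ 2 ⌋ ≡ 3
  ⌊φ2⌋ = refl
  ⌊φ3⌋ : ⌊φ 3 ⌋ ≡ 4
  ⌊φ3⌋ = refl
  ⌊φ4⌋ : ⌊φ 4 ⌋ ≡ 6
  ⌊φ4⌋ = refl

⌊φ⌋-unique : ∀ {m n} → m ≤φ n → suc m >φ n → ⌊φ n ⌋ ≡ m
⌊φ⌋-unique {m} {n} m≤φn m+1>φn =
  ≤-antisym (≤-pred (≤φ->φ⇒< (⌊φ⌋-lower n) m+1>φn)) (≤-pred (≤φ->φ⇒< m≤φn (⌊φ⌋-upper n)))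

≤φ-suc : ∀ {m n} → m ≤φ n → suc m ≤φ suc n
≤φ-suc {m} {n} m≤φn@(≤φ-intro l) = ≤φ-intro (subst₂ _≤_ (sym (lhs m)) (sym (rhs m n))
  (+-mono-≤ l (s≤s (≤-trans (+-monoʳ-≤ m m≤3n) (n≤1+n _)))))
  where
  lhs : ∀ m → suc m * suc m ≡ m * m + suc (m + m)
  lhs = solve-∀
  rhs : ∀ m n → suc m * suc n + suc n * suc n ≡ (m * n + n * n) + suc (suc (m + 3 * n))
  rhs = solve-∀
  m≤3n : m ≤ 3 * n
  m≤3n = ≤-trans (≤-pred (≤φ->φ⇒< m≤φn (2n+1>φn n))) (*-monoˡ-≤ n {2} {3} (s≤s (s≤s z≤n)))

⌊φ⌋-step : ∀ n → ⌊φ n ⌋ < ⌊φ suc n ⌋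
⌊φ⌋-step n = ≤-pred (≤φ->φ⇒< (≤φ-suc (⌊φ⌋-lower n)) (⌊φ⌋-upper (suc n)))

⌊φ⌋-mono-< : ∀ {m n} → m < n → ⌊φ m ⌋ < ⌊φ n ⌋
⌊φ⌋-mono-< {m} {suc n} m<1+n with m ≟ n
... | yes refl = ⌊φ⌋-step n
... | no m≢n = <-trans (⌊φ⌋-mono-< (≤∧≢⇒< (≤-pred m<1+n) m≢n)) (⌊φ⌋-step n)

⌊φ⌋-mono-≤ : ∀ {m n} → m ≤ n → ⌊φ m ⌋ ≤ ⌊φ n ⌋
⌊φ⌋-mono-≤ {m} {n} m≤n with m ≟ n
... | yes refl = ≤-refl
... | no m≢n = <⇒≤ (⌊φ⌋-mono-< (≤∧≢⇒< m≤n m≢n))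

⌊φ⌋-injective : ∀ {m n} → ⌊φ m ⌋ ≡ ⌊φ n ⌋ → m ≡ n
⌊φ⌋-injective {m} {n} e with <-cmp m n
... | tri< m<n _ _ = ⊥-elim (<-irrefl e (⌊φ⌋-mono-< m<n))
... | tri≈ _ m≡n _ = m≡n
... | tri> _ _ m>n = ⊥-elim (<-irrefl (sym e) (⌊φ⌋-mono-< m>n))

⌊φ⌋-positive : ∀ {n} → 1 ≤ n → ∃[ x ] ⌊φ n ⌋ ≡ suc x
⌊φ⌋-positive {n} n≥1 with ⌊φ n ⌋ | subst (_< ⌊φ n ⌋) ⌊φ0⌋ (⌊φ⌋-mono-< n≥1)
... | suc x | _ = x , refl

-- Beatty's theorem for 1/φ + 1/φ² = 1: the sequences ⌊φ n⌋ and ⌊φ n⌋ + n (n ≥ 1)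
-- are disjoint and together cover all positive integers.
⌊φ⌋-disjoint : ∀ {n m} → 1 ≤ n → 1 ≤ m → ⌊φ n ⌋ ≢ ⌊φ m ⌋ + m
⌊φ⌋-disjoint {n} {m} n≥1 m≥1 e = <⇒≱ j<n n≤j
  where
  j = ⌊φ m ⌋
  k = ⌊φ n ⌋
  -- k + j < φ k < k + n, from k = j + m > φ j and k < φ n.
  k>φj : k >φ j
  k>φj = subst (_>φ j) (sym e) (<φ⇒+>φ (≤φ⇒<φ m≥1 (⌊φ⌋-lower m)))
  j<n : j < n
  j<n = +-cancelˡ-< k j n
    (≤φ->φ⇒< (<φ⇒≤φ (>φ⇒+<φ k>φj)) (<φ⇒+>φ (≤φ⇒<φ n≥1 (⌊φ⌋-lower n))))
  -- k + 1 + n < φ (k + 1) < k + 1 + j + 1, from φ n < k + 1 and φ m < j + 1.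
  k+1<φj+1 : suc k <φ suc j
  k+1<φj+1 = subst (_<φ suc j) (cong suc (sym e)) (>φ⇒+<φ (⌊φ⌋-upper m))
  n≤j : n ≤ j
  n≤j = ≤-pred (+-cancelˡ-< (suc k) n (suc j)
    (≤φ->φ⇒< (<φ⇒≤φ (>φ⇒+<φ (⌊φ⌋-upper n))) (<φ⇒+>φ k+1<φj+1)))

-- If φ n < k and k + 1 < φ (n + 1) then k = ⌊φ x⌋ + x with x = k − n ≥ 1.
between-floors : ∀ {n k} → k >φ n → suc k <φ suc n → ∃[ x ] (1 ≤ x × ⌊φ x ⌋ + x ≡ k)
between-floors {n} {k} k>φn k+1<φn+1 with m≤n⇒∃[o]m+o≡n (<⇒≤ (>φ⇒> k>φn))
... | x , refl = x , x≥1 , cong (_+ x) ⌊φx⌋≡n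
  where
  ⌊φx⌋≡n : ⌊φ x ⌋ ≡ n
  ⌊φx⌋≡n = ⌊φ⌋-unique (<φ⇒≤φ (+>φ⇒<φ k>φn)) (+<φ⇒>φ k+1<φn+1)
  x≥1 : 1 ≤ x
  x≥1 = +-cancelˡ-≤ n 1 x (subst (_≤ n + x) (+-comm 1 n) (>φ⇒> k>φn))

suc>φ0 : ∀ k → suc k >φ 0
suc>φ0 k = >φ-intro (subst (λ z → z + 0 < suc k * suc k) (sym (*-zeroʳ (suc k))) (s≤s z≤n))

-- Take the last n with φ n < k + 1.  Either k = ⌊φ n⌋, or ⌊φ n⌋ < k and then
-- φ n < k < k + 1 < φ (n + 1), so k is an upper Beatty number by between-floors.
⌊φ⌋-cover : ∀ k → (∃[ n ] ⌊φ n ⌋ ≡ k) ⊎ (∃[ x ] (1 ≤ x × ⌊φ x ⌋ + x ≡ k))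
⌊φ⌋-cover k with last-before-failure (λ n → suc k >φ n) (λ n → suc k >φ? n) (suc k)
                  (suc>φ0 k) (λ h → <-irrefl refl (>φ⇒> h))
... | n , k+1>φn , k+1≯φn+1 with ⌊φ n ⌋ ≟ k
... | yes ⌊φn⌋≡k = inj₁ (n , ⌊φn⌋≡k)
... | no ⌊φn⌋≢k = inj₂ (between-floors (>φ-mono (⌊φ⌋-upper n) ⌊φn⌋<k)
                          (≤φ⇒<φ (s≤s z≤n) (≯φ⇒≤φ k+1≯φn+1)))
  where
  ⌊φn⌋<k : ⌊φ n ⌋ < k
  ⌊φn⌋<k = ≤∧≢⇒< (≤-pred (≤φ->φ⇒< (⌊φ⌋-lower n) k+1>φn)) ⌊φn⌋≢k

Occurs : ℕ → List ℕ → Set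
Occurs v xs = T (any (v ≡ᵇ_) xs)

mexGo-≥ : ∀ k n xs → n ≤ mexGo k n xs
mexGo-≥ zero n xs = ≤-refl
mexGo-≥ (suc k) n xs with any (n ≡ᵇ_) xs
... | true = <⇒≤ (mexGo-≥ k (suc n) xs)
... | false = ≤-refl

mex-zero : ∀ xs → ¬ Occurs 0 xs → mex xs ≡ 0
mex-zero [] _ = refl
mex-zero (x ∷ xs) ∉xs with any (0 ≡ᵇ_) (x ∷ xs)
... | true = ⊥-elim (∉xs _)
... | false = refl

mex-nonzero : ∀ xs → Occurs 0 xs → mex xs ≢ 0
mex-nonzero (x ∷ xs) ∈xs with any (0 ≡ᵇ_) (x ∷ xs)
... | true = m<n⇒n≢0 (mexGo-≥ (length xs) 1 (x ∷ xs))

mex-one : ∀ xs → Occurs 0 xs → ¬ Occurs 1 xs → mex xs ≡ 1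
mex-one (x ∷ []) 0∈ 1∉ with any (0 ≡ᵇ_) (x ∷ [])
... | true = refl
mex-one (x ∷ y ∷ xs) 0∈ 1∉ with any (0 ≡ᵇ_) (x ∷ y ∷ xs) | any (1 ≡ᵇ_) (x ∷ y ∷ xs)
... | true | false = refl
... | true | true = ⊥-elim (1∉ _)

-- A list containing both 0 and 1 has length at least 2, so mex skips past both.
mex-≥2 : ∀ xs → Occurs 0 xs → Occurs 1 xs → 2 ≤ mex xs
mex-≥2 (zero ∷ []) _ ()
mex-≥2 (suc x ∷ []) () _
mex-≥2 (x ∷ y ∷ xs) 0∈ 1∈ with any (0 ≡ᵇ_) (x ∷ y ∷ xs) | any (1 ≡ᵇ_) (x ∷ y ∷ xs)
... | true | true = mexGo-≥ (length xs) 2 (x ∷ y ∷ xs)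

mex-not-one : ∀ xs → Occurs 1 xs → mex xs ≢ 1
mex-not-one xs 1∈ with T? (any (0 ≡ᵇ_) xs)
... | yes 0∈ = λ e → <-irrefl (sym e) (mex-≥2 xs 0∈ 1∈)
... | no 0∉ = λ e → 0≢1+n (trans (sym (mex-zero xs 0∉)) e)

occurs-map : ∀ {A : Set} (g : A → ℕ) {v} {L : List A} → Any (λ p → g p ≡ v) L → Occurs v (map g L)
occurs-map g {v} h = Anyₚ.any⁺ (v ≡ᵇ_) (Anyₚ.map⁺ (Any.map (λ {p} e → ≡⇒≡ᵇ v (g p) (sym e)) h))

absent-map : ∀ {A : Set} (g : A → ℕ) {v} (L : List A) → All (λ p → g p ≢ v) L → ¬ Occurs v (map g L)
absent-map g {v} L h occ = Allₚ.All¬⇒¬Any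
  (All.map (λ {p} ne t → ne (sym (≡ᵇ⇒≡ v (g p) t))) h)
  (Anyₚ.map⁻ (Anyₚ.any⁻ (v ≡ᵇ_) (map g L) occ))

∸-suc< : ∀ {i y} → i < y → y ∸ suc i < y
∸-suc< {i} {suc y} (s≤s _) = s≤s (m∸n≤m y i)

min+max : ∀ a b → (a ⊓ b) + (a ⊔ b) ≡ a + b
min+max a b with ≤-total a b
... | inj₁ a≤b = cong₂ _+_ (m≤n⇒m⊓n≡m a≤b) (m≤n⇒m⊔n≡n a≤b)
... | inj₂ b≤a = trans (cong₂ _+_ (m≥n⇒m⊓n≡n b≤a) (m≥n⇒m⊔n≡m b≤a)) (+-comm b a)

options-decrease : ∀ a b → All (λ p → proj₁ p + proj₂ p < a + b) (options a b)
options-decrease a b = Allₚ.++⁺ (Allₚ.map⁺ (Allₚ.applyUpTo⁺₁ id (a ⊔ b) larger))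
                                (Allₚ.map⁺ (Allₚ.applyUpTo⁺₁ id (a ⊓ b) both))
  where
  larger : ∀ {i} → i < a ⊔ b → (a ⊓ b) + ((a ⊔ b) ∸ suc i) < a + b
  larger {i} i< = subst ((a ⊓ b) + ((a ⊔ b) ∸ suc i) <_) (min+max a b)
                        (+-monoʳ-< (a ⊓ b) (∸-suc< i<))
  both : ∀ {i} → i < a ⊓ b → ((a ⊓ b) ∸ suc i) + ((a ⊔ b) ∸ suc i) < a + b
  both {i} i< = subst (((a ⊓ b) ∸ suc i) + ((a ⊔ b) ∸ suc i) <_) (min+max a b)
                      (+-mono-<-≤ (∸-suc< i<) (m∸n≤m (a ⊔ b) (suc i)))

grundyF-fuel : ∀ f g a b → a + b < f → a + b < g → grundyF f a b ≡ grundyF g a b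
grundyF-fuel (suc f) (suc g) a b (s≤s ≤f) (s≤s ≤g) = cong mex (map-cong-local
  (All.map (λ {p} p< → grundyF-fuel f g (proj₁ p) (proj₂ p) (<-≤-trans p< ≤f) (<-≤-trans p< ≤g))
           (options-decrease a b)))

value : ℕ × ℕ → ℕ
value p = 𝒢 (proj₁ p) (proj₂ p)

𝒢-unfold : ∀ a b → 𝒢 a b ≡ mex (map value (options a b))
𝒢-unfold a b = cong mex (map-cong-local
  (All.map (λ {p} p< → grundyF-fuel (a + b) (suc (proj₁ p + proj₂ p)) (proj₁ p) (proj₂ p) p< ≤-refl)
           (options-decrease a b)))

𝒢-sym : ∀ a b → 𝒢 a b ≡ 𝒢 b a
𝒢-sym a b = trans (grundyF-fuel (suc (a + b)) (suc (b + a)) a b ≤-refl (s≤s (≤-reflexive (+-comm a b))))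
                  (cong (λ L → mex (map (λ p → grundyF (b + a) (proj₁ p) (proj₂ p)) L)) options-sym)
  where
  options-sym : options a b ≡ options b a
  options-sym rewrite ⊓-comm a b | ⊔-comm a b = refl

-- Moves between normalised positions: from (a , a + d) one move reaches (x , x + e).
data Move (a d : ℕ) : ℕ → ℕ → Set where
  -- the larger pile is reduced but stays at least a: (a , a + e) with e < d
  shrink   : ∀ {e} → e < d → Move a d a e
  -- the larger pile drops to c < a, leaving (c , a) = (c , c + e)
  undercut : ∀ {c e} → 1 ≤ e → c + e ≡ a → Move a d c e
  -- both piles are reduced equally: (x , x + d) with x < a
  diagonal : ∀ {x} → x < a → Move a d x d

options-normal : ∀ a d → options a (a + d) ≡
  map (λ i → (a , (a + d) ∸ suc i)) (upTo (a + d)) ++ map (λ i → (a ∸ suc i , (a + d) ∸ suc i)) (upTo a)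
options-normal a d rewrite m≤n⇒m⊓n≡m (m≤m+n a d) | m≤n⇒m⊔n≡n (m≤m+n a d) = refl

-- The option removing c's complement: the index of a given target in the option list.
∸-∸-suc : ∀ {c n} → c < n → n ∸ suc (n ∸ suc c) ≡ c
∸-∸-suc {c} {suc n} (s≤s c≤n) = m∸[m∸n]≡n c≤n

1≤∸ : ∀ {c a} → c < a → 1 ≤ a ∸ c
1≤∸ {zero} {suc a} _ = s≤s z≤n
1≤∸ {suc c} {suc a} (s≤s c<a) = 1≤∸ c<a

Realises : ℕ → ℕ → ℕ × ℕ → Set
Realises a d p = ∃[ x ] ∃[ e ] (Move a d x e × value p ≡ 𝒢 x (x + e))

options-sound : ∀ a d → All (Realises a d) (options a (a + d))
options-sound a d rewrite options-normal a d =
  Allₚ.++⁺ (Allₚ.map⁺ (Allₚ.applyUpTo⁺₁ id (a + d) larger)) (Allₚ.map⁺ (Allₚ.applyUpTo⁺₁ id a both))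
  where
  larger : ∀ {i} → i < a + d → Realises a d (a , (a + d) ∸ suc i)
  larger {i} i< with a ≤? (a + d) ∸ suc i
  ... | yes a≤ = _ , _ , shrink (+-cancelˡ-< a _ _ (subst (_< a + d) (sym (m+[n∸m]≡n a≤)) (∸-suc< i<)))
                , cong (𝒢 a) (sym (m+[n∸m]≡n a≤))
  ... | no a≰ = c , a ∸ c , undercut (1≤∸ (≰⇒> a≰)) c+e≡a , trans (𝒢-sym a c) (cong (𝒢 c) (sym c+e≡a))
    where
    c = (a + d) ∸ suc i
    c+e≡a : c + (a ∸ c) ≡ a
    c+e≡a = m+[n∸m]≡n (<⇒≤ (≰⇒> a≰))
  both : ∀ {i} → i < a → Realises a d (a ∸ suc i , (a + d) ∸ suc i)
  both {i} i< = _ , _ , diagonal (∸-suc< i<) , cong (𝒢 (a ∸ suc i)) (+-∸-comm d i<)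

options-complete : ∀ {a d x e} → Move a d x e → Any (λ p → value p ≡ 𝒢 x (x + e)) (options a (a + d))
options-complete {a} {d} {x} {e} m rewrite options-normal a d = target m
  where
  larger : ∀ {c} → c < a + d → Any (λ p → value p ≡ 𝒢 a c)
             (map (λ i → (a , (a + d) ∸ suc i)) (upTo (a + d)))
  larger c< = Anyₚ.map⁺ (Anyₚ.applyUpTo⁺ id (cong (𝒢 a) (∸-∸-suc c<)) (∸-suc< c<))
  target : Move a d x e → Any (λ p → value p ≡ 𝒢 x (x + e)) _
  target (shrink e<d) = Anyₚ.++⁺ˡ (larger (+-monoʳ-< a e<d))
  target (undercut {c} 1≤e refl) = Anyₚ.++⁺ˡ (Any.map (λ v≡ → trans v≡ (𝒢-sym (c + e) c))
    (larger (<-≤-trans (m<m+n c 1≤e) (m≤m+n (c + e) d))))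
  target (diagonal x<a) = Anyₚ.++⁺ʳ _ (Anyₚ.map⁺ (Anyₚ.applyUpTo⁺ id
    (cong₂ 𝒢 (∸-∸-suc x<a) (trans (+-∸-comm d (∸-suc< x<a)) (cong (_+ d) (∸-∸-suc x<a)))) (∸-suc< x<a)))

option-values : ℕ → ℕ → List ℕ
option-values a d = map value (options a (a + d))

move-occurs : ∀ {a d x e v} → Move a d x e → 𝒢 x (x + e) ≡ v → Occurs v (option-values a d)
move-occurs m 𝒢≡v = occurs-map value (Any.map (λ q → trans q 𝒢≡v) (options-complete m))

no-move-absent : ∀ {a d} v → (∀ {x e} → Move a d x e → 𝒢 x (x + e) ≢ v) →
  ¬ Occurs v (option-values a d)
no-move-absent {a} {d} v none = absent-map value (options a (a + d))
  (All.map (λ { (x , e , m , q) r → none m (trans (sym q) r) }) (options-sound a d))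

𝒢-zero : ∀ {a d} → (∀ {x e} → Move a d x e → 𝒢 x (x + e) ≢ 0) → 𝒢 a (a + d) ≡ 0
𝒢-zero {a} {d} none = trans (𝒢-unfold a (a + d)) (mex-zero (option-values a d) (no-move-absent 0 none))

𝒢-nonzero : ∀ {a d x e} → Move a d x e → 𝒢 x (x + e) ≡ 0 → 𝒢 a (a + d) ≢ 0
𝒢-nonzero {a} {d} m 𝒢≡0 e =
  mex-nonzero (option-values a d) (move-occurs m 𝒢≡0) (trans (sym (𝒢-unfold a (a + d))) e)

𝒢-one : ∀ {a d x e} → Move a d x e → 𝒢 x (x + e) ≡ 0 →
  (∀ {y f} → Move a d y f → 𝒢 y (y + f) ≢ 1) → 𝒢 a (a + d) ≡ 1
𝒢-one {a} {d} m 𝒢≡0 none = trans (𝒢-unfold a (a + d))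
  (mex-one (option-values a d) (move-occurs m 𝒢≡0) (no-move-absent 1 none))

𝒢-not-one : ∀ {a d x e} → Move a d x e → 𝒢 x (x + e) ≡ 1 → 𝒢 a (a + d) ≢ 1
𝒢-not-one {a} {d} m 𝒢≡1 e =
  mex-not-one (option-values a d) (move-occurs m 𝒢≡1) (trans (sym (𝒢-unfold a (a + d))) e)

move-shrinks : ∀ {a d x e} → Move a d x e → x + (x + e) < a + (a + d)
move-shrinks {a} {d} (shrink e<d) = +-monoʳ-< a (+-monoʳ-< a e<d)
move-shrinks {a} {d} (undercut {c} {e} 1≤e refl) = +-mono-<-≤ (m<m+n c 1≤e) (m≤m+n (c + e) d)
move-shrinks {a} {d} (diagonal x<a) = +-mono-<-≤ x<a (+-monoˡ-≤ d (<⇒≤ x<a))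

CanReach : (ℕ → ℕ → Set) → ℕ → ℕ → Set
CanReach S a d = ∃[ x ] ∃[ e ] (Move a d x e × S x e)

module Characterisation
  (P Q : ℕ → ℕ → Set)
  (P? : ∀ a d → Dec (P a d)) (Q? : ∀ a d → Dec (Q a d))
  (P-independent : ∀ {a d x e} → P a d → Move a d x e → ¬ P x e)
  (P-absorbing   : ∀ {a d} → ¬ P a d → CanReach P a d)
  (Q-outside-P   : ∀ {a d} → Q a d → ¬ P a d)
  (Q-independent : ∀ {a d x e} → Q a d → Move a d x e → ¬ Q x e)
  (Q-absorbing   : ∀ {a d} → ¬ P a d → ¬ Q a d → CanReach Q a d)
  where

  record Values (a d : ℕ) : Set where
    field
      zero⇔P : 𝒢 a (a + d) ≡ 0 ⇔ P a d
      one⇔Q  : 𝒢 a (a + d) ≡ 1 ⇔ Q a d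
  open Values
  open Equivalence

  values-below : ∀ s a d → a + (a + d) < s → Values a d
  values-below (suc s) a d (s≤s bound) = record
    { zero⇔P = mk⇔ zero⇒P P⇒zero ; one⇔Q = mk⇔ one⇒Q Q⇒one }
    where
    IH : ∀ {x e} → Move a d x e → Values x e
    IH m = values-below s _ _ (<-≤-trans (move-shrinks m) bound)

    P⇒zero : P a d → 𝒢 a (a + d) ≡ 0
    P⇒zero p = 𝒢-zero (λ m 𝒢≡0 → P-independent p m (to (zero⇔P (IH m)) 𝒢≡0))

    zero⇒P : 𝒢 a (a + d) ≡ 0 → P a d
    zero⇒P 𝒢≡0 with P? a d
    ... | yes p = p
    ... | no ¬p with P-absorbing ¬p
    ... | _ , _ , m , p = ⊥-elim (𝒢-nonzero m (from (zero⇔P (IH m)) p) 𝒢≡0)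

    Q⇒one : Q a d → 𝒢 a (a + d) ≡ 1
    Q⇒one q with P-absorbing (Q-outside-P q)
    ... | _ , _ , m , p = 𝒢-one m (from (zero⇔P (IH m)) p)
                                (λ m′ 𝒢≡1 → Q-independent q m′ (to (one⇔Q (IH m′)) 𝒢≡1))

    one⇒Q : 𝒢 a (a + d) ≡ 1 → Q a d
    one⇒Q 𝒢≡1 with Q? a d | P? a d
    ... | yes q | _ = q
    ... | no _  | yes p = ⊥-elim (0≢1+n (trans (sym (P⇒zero p)) 𝒢≡1))
    ... | no ¬q | no ¬p with Q-absorbing ¬p ¬q
    ... | _ , _ , m , q = ⊥-elim (𝒢-not-one m (from (one⇔Q (IH m)) q) 𝒢≡1)

  values : ∀ a d → Values a d
  values a d = values-below _ a d ≤-refl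

IsP : ℕ → ℕ → Set
IsP a d = ⌊φ d ⌋ ≡ a

IsQ : ℕ → ℕ → Set
IsQ a d = (a ≡ 2 × d ≡ 0) ⊎ (a ≡ 4 × d ≡ 2) ⊎ (1 ≤ d × d ≢ 2 × ⌊φ d ⌋ ≡ suc a)

pattern q-2-2 = inj₁ (refl , refl)
pattern q-4-6 = inj₂ (inj₁ (refl , refl))
pattern q-shifted d≥1 d≢2 ⌊φd⌋≡ = inj₂ (inj₂ (d≥1 , d≢2 , ⌊φd⌋≡))

q-0-1 : IsQ 0 1
q-0-1 = q-shifted (s≤s z≤n) (λ ()) ⌊φ1⌋

IsP? : ∀ a d → Dec (IsP a d)
IsP? a d = ⌊φ d ⌋ ≟ a

IsQ? : ∀ a d → Dec (IsQ a d)
IsQ? a d = ((a ≟ 2) ×-dec (d ≟ 0)) ⊎-dec ((a ≟ 4) ×-dec (d ≟ 2))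
             ⊎-dec ((1 ≤? d) ×-dec (¬? (d ≟ 2) ×-dec (⌊φ d ⌋ ≟ suc a)))

-- No move joins two P-positions: this is injectivity of ⌊φ_⌋ and the disjointness
-- of the two Beatty sequences.
P-independent : ∀ {a d x e} → IsP a d → Move a d x e → ¬ IsP x e
P-independent p (shrink e<d) p′ = <-irrefl (⌊φ⌋-injective (trans p′ (sym p))) e<d
P-independent {d = zero} p (undercut {c} {e} e≥1 refl) p′ =
  m<n⇒n≢0 (≤-trans e≥1 (m≤n+m e c)) (trans (sym p) ⌊φ0⌋)
P-independent {d = suc d} p (undercut e≥1 refl) p′ =
  ⌊φ⌋-disjoint (s≤s z≤n) e≥1 (trans p (cong (_+ _) (sym p′)))
P-independent p (diagonal x<a) p′ = <-irrefl (trans (sym p′) p) x<a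

-- Every other position moves into P: its smaller pile a lies in one of the two Beatty sequences.
P-absorbing : ∀ {a d} → ¬ IsP a d → CanReach IsP a d
P-absorbing {zero} {zero} ¬p = ⊥-elim (¬p ⌊φ0⌋)
P-absorbing {zero} {suc d} _ = 0 , 0 , shrink (s≤s z≤n) , ⌊φ0⌋
P-absorbing {suc a} {d} ¬p with ⌊φ⌋-cover (suc a)
... | inj₂ (m , m≥1 , ⌊φm⌋+m≡) = ⌊φ m ⌋ , m , undercut m≥1 ⌊φm⌋+m≡ , refl
... | inj₁ (n , ⌊φn⌋≡) with <-cmp d n
... | tri< d<n _ _ = ⌊φ d ⌋ , d , diagonal (subst (⌊φ d ⌋ <_) ⌊φn⌋≡ (⌊φ⌋-mono-< d<n)) , refl
... | tri≈ _ refl _ = ⊥-elim (¬p ⌊φn⌋≡)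
... | tri> _ _ d>n = suc a , n , shrink d>n , ⌊φn⌋≡

Q-outside-P : ∀ {a d} → IsQ a d → ¬ IsP a d
Q-outside-P q-2-2 p = 0≢1+n (trans (sym ⌊φ0⌋) p)
Q-outside-P q-4-6 p = <-irrefl (trans (sym ⌊φ2⌋) p) (n<1+n 3)
Q-outside-P (q-shifted _ _ ⌊φd⌋≡) p = <-irrefl (trans (sym p) ⌊φd⌋≡) (n<1+n _)

move-≤ : ∀ {a d x e} → Move a d x e → x ≤ a
move-≤ (shrink _) = ≤-refl
move-≤ (undercut {c} {e} _ refl) = m≤m+n c e
move-≤ (diagonal x<a) = <⇒≤ x<a

data SmallQ : ℕ → ℕ → Set where
  sq-0-1 : SmallQ 0 1
  sq-2-2 : SmallQ 2 0
  sq-3-6 : SmallQ 3 3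
  sq-4-6 : SmallQ 4 2

small-Q : ∀ {a d} → a ≤ 4 → IsQ a d → SmallQ a d
small-Q _ q-2-2 = sq-2-2
small-Q _ q-4-6 = sq-4-6
small-Q {d = 1} _ (q-shifted _ _ ⌊φ1⌋≡) with trans (sym ⌊φ1⌋) ⌊φ1⌋≡
... | refl = sq-0-1
small-Q {d = 2} _ (q-shifted _ d≢2 _) = ⊥-elim (d≢2 refl)
small-Q {d = 3} _ (q-shifted _ _ ⌊φ3⌋≡) with trans (sym ⌊φ3⌋) ⌊φ3⌋≡
... | refl = sq-3-6
small-Q {a} {d = suc (suc (suc (suc d)))} a≤4 (q-shifted _ _ ⌊φd⌋≡) =
  ⊥-elim (<⇒≱ (s≤s (s≤s a≤4)) (subst₂ _≤_ ⌊φ4⌋ ⌊φd⌋≡ (⌊φ⌋-mono-≤ (s≤s (s≤s (s≤s (s≤s z≤n)))))))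

from-2-2 : ∀ {x e} → Move 2 0 x e → ¬ SmallQ x e
from-2-2 (undercut _ ()) sq-0-1
from-2-2 (undercut () _) sq-2-2
from-2-2 (diagonal (s≤s (s≤s ()))) sq-2-2
from-2-2 (undercut _ ()) sq-3-6
from-2-2 (undercut _ ()) sq-4-6

from-4-6 : ∀ {x e} → Move 4 2 x e → ¬ SmallQ x e
from-4-6 (undercut _ ()) sq-0-1
from-4-6 (undercut () _) sq-2-2
from-4-6 (undercut _ ()) sq-3-6
from-4-6 (shrink (s≤s (s≤s ()))) sq-4-6
from-4-6 (undercut _ ()) sq-4-6
from-4-6 (diagonal (s≤s (s≤s (s≤s (s≤s ()))))) sq-4-6

-- From (⌊φ d⌋ − 1 , ⌊φ d⌋ − 1 + d) every target misses Q, again by injectivity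
-- of ⌊φ_⌋ and disjointness of the Beatty sequences.
from-shifted : ∀ {a d x e} → 1 ≤ d → d ≢ 2 → ⌊φ d ⌋ ≡ suc a → Move a d x e → ¬ IsQ x e
from-shifted _ d≢2 ⌊φd⌋≡ (shrink _) q-2-2 = d≢2 (⌊φ⌋-injective (trans ⌊φd⌋≡ (sym ⌊φ2⌋)))
from-shifted d≥1 _ ⌊φd⌋≡ (shrink _) q-4-6 =
  ⌊φ⌋-disjoint d≥1 (s≤s z≤n) (trans ⌊φd⌋≡ (cong (_+ 2) (sym ⌊φ2⌋)))
from-shifted _ _ ⌊φd⌋≡ (shrink e<d) (q-shifted _ _ ⌊φe⌋≡) =
  <-irrefl (⌊φ⌋-injective (trans ⌊φe⌋≡ (sym ⌊φd⌋≡))) e<d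
from-shifted _ _ _ (undercut () _) q-2-2
from-shifted d≥1 _ ⌊φd⌋≡ (undercut _ refl) q-4-6 =
  ⌊φ⌋-disjoint d≥1 (s≤s z≤n) (trans ⌊φd⌋≡ (cong (_+ 3) (sym ⌊φ3⌋)))
from-shifted d≥1 _ ⌊φd⌋≡ (undercut {e = e} e≥1 refl) (q-shifted _ _ ⌊φe⌋≡) =
  ⌊φ⌋-disjoint d≥1 e≥1 (trans ⌊φd⌋≡ (cong (_+ e) (sym ⌊φe⌋≡)))
from-shifted () _ _ (diagonal _) q-2-2
from-shifted _ d≢2 _ (diagonal _) q-4-6 = d≢2 refl
from-shifted _ _ ⌊φd⌋≡ (diagonal x<a) (q-shifted _ _ ⌊φd⌋≡′) =
  <-irrefl (suc-injective (trans (sym ⌊φd⌋≡′) ⌊φd⌋≡)) x<a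

Q-independent : ∀ {a d x e} → IsQ a d → Move a d x e → ¬ IsQ x e
Q-independent q-2-2 m q = from-2-2 m (small-Q (≤-trans (move-≤ m) (s≤s (s≤s z≤n))) q)
Q-independent q-4-6 m q = from-4-6 m (small-Q (move-≤ m) q)
Q-independent (q-shifted d≥1 d≢2 ⌊φd⌋≡) m q = from-shifted d≥1 d≢2 ⌊φd⌋≡ m q

lower-row-index : ∀ {n a} → ⌊φ n ⌋ ≡ suc (suc a) → n ≢ 2 → 3 ≤ n
lower-row-index {0} ⌊φn⌋≡ _ = ⊥-elim (0≢1+n (trans (sym ⌊φ0⌋) ⌊φn⌋≡))
lower-row-index {1} ⌊φn⌋≡ _ = ⊥-elim (0≢1+n (suc-injective (trans (sym ⌊φ1⌋) ⌊φn⌋≡)))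
lower-row-index {2} _ n≢2 = ⊥-elim (n≢2 refl)
lower-row-index {suc (suc (suc n))} _ _ = s≤s (s≤s (s≤s z≤n))

lower-row-bound : ∀ {n a} → ⌊φ n ⌋ ≡ suc (suc a) → n ≢ 2 → 2 ≤ a
lower-row-bound {n} ⌊φn⌋≡ n≢2 =
  ≤-pred (≤-pred (subst₂ _≤_ ⌊φ3⌋ ⌊φn⌋≡ (⌊φ⌋-mono-≤ (lower-row-index ⌊φn⌋≡ n≢2))))

-- From such a smaller pile, (4,6) is diagonally reachable with d = 2 unless the position is (3,5) ∈ P,
-- or the pile is 4, which would make 5 = ⌊φ 2⌋ + 2 a lower Beatty number.
row-beyond-4 : ∀ {n a} → ⌊φ n ⌋ ≡ suc (suc a) → n ≢ 2 → ¬ IsP (suc a) 2 → 4 < suc a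
row-beyond-4 {n} {a} ⌊φn⌋≡ n≢2 ¬p with lower-row-bound ⌊φn⌋≡ n≢2
row-beyond-4 {a = 0} _ _ _ | ()
row-beyond-4 {a = 1} _ _ _ | s≤s ()
row-beyond-4 {a = 2} _ _ ¬p | _ = ⊥-elim (¬p ⌊φ2⌋)
row-beyond-4 {a = 3} ⌊φn⌋≡ n≢2 _ | _ =
  ⊥-elim (⌊φ⌋-disjoint (≤-trans (s≤s z≤n) (lower-row-index ⌊φn⌋≡ n≢2)) (s≤s z≤n)
                       (trans ⌊φn⌋≡ (cong (_+ 2) (sym ⌊φ2⌋))))
row-beyond-4 {a = suc (suc (suc (suc a)))} _ _ _ | _ = s≤s (s≤s (s≤s (s≤s (s≤s z≤n))))

diagonal-to-shifted : ∀ {a d n} → 1 ≤ d → d ≢ 2 → d < n → ⌊φ n ⌋ ≡ suc (suc a) →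
  CanReach IsQ (suc a) d
diagonal-to-shifted {a} {d} d≥1 d≢2 d<n ⌊φn⌋≡ with ⌊φ⌋-positive d≥1
... | x , ⌊φd⌋≡ = x , d , diagonal x<a+1 , q-shifted d≥1 d≢2 ⌊φd⌋≡
  where
  x<a+1 : x < suc a
  x<a+1 = ≤-pred (subst₂ _<_ ⌊φd⌋≡ ⌊φn⌋≡ (⌊φ⌋-mono-< d<n))

diagonal-to-Q : ∀ {a d n} → ⌊φ n ⌋ ≡ suc (suc a) → n ≢ 2 → d < n → ¬ IsP (suc a) d →
  CanReach IsQ (suc a) d
diagonal-to-Q {d = 0} ⌊φn⌋≡ n≢2 _ _ = 2 , 0 , diagonal (s≤s (lower-row-bound ⌊φn⌋≡ n≢2)) , q-2-2
diagonal-to-Q {d = 1} _ _ _ _ = 0 , 1 , diagonal (s≤s z≤n) , q-0-1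
diagonal-to-Q {d = 2} ⌊φn⌋≡ n≢2 _ ¬p = 4 , 2 , diagonal (row-beyond-4 ⌊φn⌋≡ n≢2 ¬p) , q-4-6
diagonal-to-Q {d = suc (suc (suc _))} ⌊φn⌋≡ _ d<n _ = diagonal-to-shifted (s≤s z≤n) (λ ()) d<n ⌊φn⌋≡

-- Smaller pile 2 = ⌊φ 2⌋ − 1: from (2 , 2 + d), d ≥ 1, shrink to (2 , 2).
row-2 : ∀ {a d} → ⌊φ 2 ⌋ ≡ suc (suc a) → ¬ IsQ (suc a) d → CanReach IsQ (suc a) d
row-2 ⌊φ2⌋≡ ¬q with suc-injective (suc-injective (trans (sym ⌊φ2⌋) ⌊φ2⌋≡))
row-2 {d = zero} _ ¬q | refl = ⊥-elim (¬q q-2-2)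
row-2 {d = suc _} _ _ | refl = 2 , 0 , shrink (s≤s z≤n) , q-2-2

-- Smaller pile 4 = ⌊φ 2⌋ + 2 − 1: from (4 , 4 + d), d ≠ 2, reach (2 , 2) or (0 , 1) diagonally
-- or shrink to (4 , 6).
row-4 : ∀ {a d} → ⌊φ 2 ⌋ + 2 ≡ suc (suc a) → ¬ IsQ (suc a) d → CanReach IsQ (suc a) d
row-4 ⌊φ2⌋+2≡ ¬q with suc-injective (suc-injective (trans (cong (_+ 2) (sym ⌊φ2⌋)) ⌊φ2⌋+2≡))
row-4 {d = 0} _ _ | refl = 2 , 0 , diagonal (s≤s (s≤s (s≤s z≤n))) , q-2-2
row-4 {d = 1} _ _ | refl = 0 , 1 , diagonal (s≤s z≤n) , q-0-1
row-4 {d = 2} _ ¬q | refl = ⊥-elim (¬q q-4-6)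
row-4 {d = suc (suc (suc _))} _ _ | refl = 4 , 2 , shrink (s≤s (s≤s (s≤s z≤n))) , q-4-6

-- Smaller pile a + 1 = ⌊φ n⌋ − 1: shrink to (⌊φ n⌋ − 1 , ⌊φ n⌋ − 1 + n) or move diagonally.
from-lower-row : ∀ {a d n} → ⌊φ n ⌋ ≡ suc (suc a) → ¬ IsP (suc a) d → ¬ IsQ (suc a) d →
  CanReach IsQ (suc a) d
from-lower-row {a} {d} {n} ⌊φn⌋≡ ¬p ¬q with n ≟ 2
... | yes refl = row-2 ⌊φn⌋≡ ¬q
... | no n≢2 with <-cmp d n | ≤-trans (s≤s z≤n) (lower-row-index ⌊φn⌋≡ n≢2)
...   | tri< d<n _ _ | _   = diagonal-to-Q ⌊φn⌋≡ n≢2 d<n ¬p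
...   | tri≈ _ refl _ | n≥1 = ⊥-elim (¬q (q-shifted n≥1 n≢2 ⌊φn⌋≡))
...   | tri> _ _ d>n | n≥1 = suc a , n , shrink d>n , q-shifted n≥1 n≢2 ⌊φn⌋≡

-- Smaller pile a + 1 = ⌊φ m⌋ + m − 1: undercut to (⌊φ m⌋ − 1 , ⌊φ m⌋ − 1 + m), unless
-- m = 2, where the pile is 4 and (2,2), (0,1) or (4,6) is reachable instead.
from-upper-row : ∀ {a d m} → 1 ≤ m → ⌊φ m ⌋ + m ≡ suc (suc a) → ¬ IsQ (suc a) d →
  CanReach IsQ (suc a) d
from-upper-row {a} {d} {m} m≥1 ⌊φm⌋+m≡ ¬q with m ≟ 2
... | yes refl = row-4 ⌊φm⌋+m≡ ¬q
... | no m≢2 with ⌊φ⌋-positive m≥1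
... | x , ⌊φm⌋≡ = x , m , undercut m≥1 (suc-injective (trans (cong (_+ m) (sym ⌊φm⌋≡)) ⌊φm⌋+m≡))
                 , q-shifted m≥1 m≢2 ⌊φm⌋≡

-- Outside P ∪ Q some move reaches Q.  For a smaller pile a + 1 ≥ 1, Beatty's theorem
-- places a + 2 in the lower or in the upper sequence.
Q-absorbing : ∀ {a d} → ¬ IsP a d → ¬ IsQ a d → CanReach IsQ a d
Q-absorbing {zero} {zero} ¬p _ = ⊥-elim (¬p ⌊φ0⌋)
Q-absorbing {zero} {suc zero} _ ¬q = ⊥-elim (¬q q-0-1)
Q-absorbing {zero} {suc (suc d)} _ _ = 0 , 1 , shrink (s≤s (s≤s z≤n)) , q-0-1
Q-absorbing {suc a} ¬p ¬q with ⌊φ⌋-cover (suc (suc a))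
... | inj₁ (n , ⌊φn⌋≡) = from-lower-row ⌊φn⌋≡ ¬p ¬q
... | inj₂ (m , m≥1 , ⌊φm⌋+m≡) = from-upper-row m≥1 ⌊φm⌋+m≡ ¬q

open Characterisation IsP IsQ IsP? IsQ? P-independent P-absorbing Q-outside-P Q-independent
  Q-absorbing

ValueOneSet : ℕ → ℕ → Set
ValueOneSet a b = ((a ≡ 2) × (b ≡ 2)) ⊎ ((a ≡ 4) × (b ≡ 6)) ⊎
  (∃[ n ] ∃[ m ] (1 ≤ n × n ≢ 2 × IsFloorPhi n m × suc a ≡ m × suc b ≡ m + n))

-- Q is that set: ⌊φ_⌋ is the unique solution of IsFloorPhi.
IsQ⇔ValueOneSet : ∀ a d → IsQ a d ⇔ ValueOneSet a (a + d)
IsQ⇔ValueOneSet a d = mk⇔ to from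
  where
  to : IsQ a d → ValueOneSet a (a + d)
  to q-2-2 = inj₁ (refl , refl)
  to q-4-6 = inj₂ (inj₁ (refl , refl))
  to (q-shifted d≥1 d≢2 ⌊φd⌋≡) = inj₂ (inj₂ (d , ⌊φ d ⌋ , d≥1 , d≢2 ,
    (≤φ⇒LeqPhi (⌊φ⌋-lower d) , >φ⇒PhiLt (⌊φ⌋-upper d)) , sym ⌊φd⌋≡ , cong (_+ d) (sym ⌊φd⌋≡)))
  from : ValueOneSet a (a + d) → IsQ a d
  from (inj₁ (refl , 2+d≡2)) = inj₁ (refl , +-cancelˡ-≡ 2 d 0 2+d≡2)
  from (inj₂ (inj₁ (refl , 4+d≡6))) = inj₂ (inj₁ (refl , +-cancelˡ-≡ 4 d 2 4+d≡6))
  from (inj₂ (inj₂ (n , m , n≥1 , n≢2 , (m≤φn , φn<m+1) , a+1≡m , b+1≡m+n)))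
    rewrite +-cancelˡ-≡ (suc a) d n (trans b+1≡m+n (cong (_+ n) (sym a+1≡m))) =
    q-shifted n≥1 n≢2 (trans (⌊φ⌋-unique (LeqPhi⇒≤φ m≤φn) (PhiLt⇒>φ φn<m+1)) (sym a+1≡m))

theorem2p4 : (a b : ℕ) → a ≤ b →
    (𝒢 a b ≡ 1) ⇔
      (((a ≡ 2) × (b ≡ 2)) ⊎ ((a ≡ 4) × (b ≡ 6)) ⊎
        (∃[ n ] ∃[ m ] (1 ≤ n × n ≢ 2 × IsFloorPhi n m × suc a ≡ m × suc b ≡ m + n)))
theorem2p4 a b a≤b with m≤n⇒∃[o]m+o≡n a≤b
... | d , refl = ⇔.trans (Values.one⇔Q (values a d)) (IsQ⇔ValueOneSet a d)
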